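{- Let $(A,L)$ and $(B,M)$ be live automata with the same external actions, and suppose $(A,L)\le_{i\ell B}(B,M)$ via $b=(g,h)$ with respect to invariants $I_A$ of $A$ and $I_B$ of $B$. Let $\alpha=s_0a_1s_1\ldots$ be any execution of $A$, and let $G$ be the digraph induced by $\alpha$, $b$, $I_B$, $L$ and $M$. Then: (1) for each $i$ with $0\le i\le|\alpha|$ there is at least one node of $G$ of the form $(u,i)$; (2) the roots of $G$ (nodes with no incoming edges) are exactly the nodes of the form $(u,0)$; (3) $G$ has finitely many roots; (4) each node of $G$ has finite outdegree; (5) each node of $G$ is reachable from some root of $G$.
   Context: An automaton $A$ has states, nonempty start states $\mathit{start}(A)$, disjoint external/internal actions, and transitions $s\xrightarrow{a}_As'$. An execution fragment is an alternating sequence $s_0a_1s_1\ldots$ (ending in a state if finite) following transitions; $|\alpha|$ is its number of actions; $\mathit{fstate},\mathit{lstate}$ first/last state; an execution starts in a start state. Reachable states are those occurring in executions; an invariant is a set containing all reachable states. Trace of an action: itself if external, empty otherwise; fragment traces concatenate action traces. $R[s]=\{u\mid(s,u)\in R\}$. Complemented pair $p=\langle p.\mathsf{R},p.\mathsf{G}\rangle$ of state sets; infinite $\alpha\models p$ iff (infinitely many positions in $p.\mathsf{R}$ implies infinitely many in $p.\mathsf{G}$). Live automaton $(A,L)$: $L$ a set of complemented pairs such that every finite execution has a proper infinite extension execution satisfying all of $L$; live executions are infinite executions satisfying all of $L$; $\widehat L$ = complemented pairs satisfied by all live executions. For finite $\beta$, $\beta\in U$ means some state of $\beta$ lies in $U$.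 $(A,L)\le_{i\ell B}(B,M)$ via $(g,h)$ w.r.t. $I_A,I_B$: $g\subseteq\mathit{states}(A)\times\mathit{states}(B)$ with $g[s]$ finite for all $s$, $h:M\to\widehat L$ total, and (1) $s\in I_A\Rightarrow g[s]\cap I_B\ne\emptyset$; (2) $s\in\mathit{start}(A)\Rightarrow g[s]\cap I_B\subseteq\mathit{start}(B)$; (3) if $s\xrightarrow{a}_As'$, $s\in I_A$, $u'\in g[s']\cap I_B$ then some finite fragment $\beta$ of $B$ has $\mathit{fstate}(\beta)\in g[s]\cap I_B$, $\mathit{lstate}(\beta)=u'$, trace of $a$, and for all $q\in M$, $p=h(q)$: $\beta\in q.\mathsf{R}\Rightarrow(s\in p.\mathsf{R}$ or $s'\in p.\mathsf{R})$ and $(s\in p.\mathsf{G}$ or $s'\in p.\mathsf{G})\Rightarrow\beta\in q.\mathsf{G}$; (4) calling $s\xrightarrow{a}_As'$ sometimes-silent if $s\in I_A$ and some finite fragment $\beta$ of $B$ with $\mathit{fstate}(\beta)\in g[s]\cap I_B$, $\mathit{lstate}(\beta)\in g[s']$ and trace of $a$ has $|\beta|=0$, every live execution of $(A,L)$ contains infinitely many non-sometimes-silent transitions. Induced digraph $G$: nodes are pairs $(u,i)$ with $0\le i\le|\alpha|$ and $u\in g[s_i]\cap I_B$; there is an edge from $(u,i)$ to $(u',i')$ iff $i'=i+1$ and there is a finite execution fragment $\beta$ of $B$ with $\mathit{fstate}(\beta)=u$, $\mathit{lstate}(\beta)=u'$, trace equal to the trace of $a_{i+1}$, and for all $q\in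 M$, with $p=h(q)$: if $\beta\in q.\mathsf{R}$ then $s_i\in p.\mathsf{R}$ or $s_{i+1}\in p.\mathsf{R}$; if $s_i\in p.\mathsf{G}$ or $s_{i+1}\in p.\mathsf{G}$ then $\beta\in q.\mathsf{G}$. -}

module Defs where

open import Data.Nat using (ℕ; zero; suc; _≤_; _<_)
open import Data.Maybe using (Maybe; just; nothing)
open import Data.List using (List; []; _∷_; _++_)
open import Data.List.Membership.Propositional using (_∈_)
open import Data.Product using (Σ; ∃; _×_; _,_; proj₁; proj₂)
open import Data.Sum using (_⊎_; inj₁; inj₂)
open import Data.Unit using (⊤)
open import Relation.Nullary using (¬_)
open import Relation.Binary.PropositionalEquality using (_≡_)

-- Actions are  E ⊎ Int : external actions (inj₁) and internal ones (inj₂),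
-- so external and internal actions are disjoint, and two automata over
-- the same E have the same external actions.

record Automaton (E : Set) : Set₁ where
  field
    State : Set
    Int   : Set
    start : State → Set
    step  : State → (E ⊎ Int) → State → Set
  Act : Set
  Act = E ⊎ Int
open Automaton public

actTrace : ∀ {E I : Set} → E ⊎ I → List E
actTrace (inj₁ e) = e ∷ []
actTrace (inj₂ _) = []

data Frag {E} (A : Automaton E) : State A → State A → Set where
  nil  : ∀ {u} → Frag A u u
  cons : ∀ {u v w} (a : Act A) → step A u a v → Frag A v w → Frag A u w

fragLength : ∀ {E} {A : Automaton E} {u w} → Frag A u w → ℕ
fragLength nil = 0
fragLength (cons _ _ β) = suc (fragLength β)

fragTrace : ∀ {E} {A : Automaton E} {u w} → Frag A u w → List E
fragTrace nil = []
fragTrace (cons a _ β) = actTrace a ++ fragTrace β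

InFrag : ∀ {E} {A : Automaton E} {u w} → Frag A u w → (State A → Set) → Set
InFrag {u = u} nil U = U u
InFrag {u = u} (cons _ _ β) U = U u ⊎ InFrag β U

-- Executions (finite or infinite).
-- len = just n : finite execution with n actions; len = nothing : infinite.
-- st i = s_i, act i = a_{i+1}; values outside the range are irrelevant.

InRange : Maybe ℕ → ℕ → Set
InRange (just n) i = i ≤ n
InRange nothing  i = ⊤

record Exec {E} (A : Automaton E) : Set where
  field
    len   : Maybe ℕ
    st    : ℕ → State A
    act   : ℕ → Act A
    st0   : start A (st 0)
    steps : ∀ i → InRange len (suc i) → step A (st i) (act i) (st (suc i))
open Exec public

record CPair {E} (A : Automaton E) : Set₁ where
  field
    R : State A → Set
    G : State A → Set
open CPair public

InfOften : ∀ {S : Set} → (ℕ → S) → (S → Set) → Set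
InfOften s U = ∀ n → ∃ λ m → n ≤ m × U (s m)

Sat : ∀ {E} {A : Automaton E} → Exec A → CPair A → Set
Sat α p = InfOften (st α) (R p) → InfOften (st α) (G p)

-- a set of complemented pairs is given as an indexed family  L : LI → CPair A
LiveExec : ∀ {E} {A : Automaton E} {LI : Set} → (LI → CPair A) → Exec A → Set
LiveExec L α = len α ≡ nothing × (∀ l → Sat α (L l))

IsLive : ∀ {E} (A : Automaton E) {LI : Set} → (LI → CPair A) → Set
IsLive A L = ∀ (α : Exec A) n → len α ≡ just n →
  Σ (Exec A) λ β → LiveExec L β
    × (∀ i → i ≤ n → st β i ≡ st α i)
    × (∀ i → i < n → act β i ≡ act α i)

InLHat : ∀ {E} {A : Automaton E} {LI : Set} → (LI → CPair A) → CPair A → Set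
InLHat {A = A} L p = ∀ (α : Exec A) → LiveExec L α → Sat α p

Invariant : ∀ {E} (A : Automaton E) → (State A → Set) → Set
Invariant A I = ∀ (α : Exec A) i → InRange (len α) i → I (st α i)

FiniteImage : ∀ {S T : Set} → (S → T → Set) → Set
FiniteImage {S} {T} g = ∀ s → Σ (List T) λ xs → ∀ u → g s u → u ∈ xs

PairCond : ∀ {E} {A B : Automaton E} {MI : Set} (M : MI → CPair B) (h : MI → CPair A)
  {u u' : State B} → Frag B u u' → State A → State A → Set
PairCond M h β s s' = ∀ q →
  (InFrag β (R (M q)) → R (h q) s ⊎ R (h q) s') ×
  (G (h q) s ⊎ G (h q) s' → InFrag β (G (M q)))

SometimesSilent : ∀ {E} (A B : Automaton E) (IA : State A → Set) (IB : State B → Set)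
  (g : State A → State B → Set) → State A → Act A → State A → Set
SometimesSilent A B IA IB g s a s' = IA s × ∃ λ u → ∃ λ u' →
  g s u × IB u × g s' u' × Σ (Frag B u u') λ β →
    fragTrace β ≡ actTrace a × fragLength β ≡ 0

record ILB {E} (A B : Automaton E) {LI MI : Set} (L : LI → CPair A) (M : MI → CPair B)
  (IA : State A → Set) (IB : State B → Set)
  (g : State A → State B → Set) (h : MI → CPair A) : Set where
  field
    g-fin : FiniteImage g
    h-hat : ∀ q → InLHat L (h q)
    c1 : ∀ s → IA s → ∃ λ u → g s u × IB u
    c2 : ∀ s → start A s → ∀ u → g s u → IB u → start B u
    c3 : ∀ s a s' → step A s a s' → IA s → ∀ u' → g s' u' → IB u' →
         ∃ λ u → g s u × IB u × Σ (Frag B u u') λ β →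
           fragTrace β ≡ actTrace a × PairCond M h β s s'
    c4 : ∀ (α : Exec A) → LiveExec L α →
         ∀ n → ∃ λ m → n ≤ m × ¬ SometimesSilent A B IA IB g (st α m) (act α m) (st α (suc m))

module InducedGraph {E} {A B : Automaton E} {MI : Set} (M : MI → CPair B)
  (IB : State B → Set) (g : State A → State B → Set) (h : MI → CPair A)
  (α : Exec A) where

  Node : State B × ℕ → Set
  Node (u , i) = InRange (len α) i × g (st α i) u × IB u

  Edge : State B × ℕ → State B × ℕ → Set
  Edge (u , i) (u' , i') = Node (u , i) × Node (u' , i') × i' ≡ suc i ×
    Σ (Frag B u u') λ β → fragTrace β ≡ actTrace (act α i) × PairCond M h β (st α i) (st α (suc i))

  Root : State B × ℕ → Set
  Root x = Node x × ¬ (∃ λ y → Edge y x)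

module Submission where

open import Defs
open import Data.Nat using (ℕ; zero; suc)
open import Data.Nat.Properties using (<⇒≤; 0≢1+n)
open import Data.List using (List; map)
open import Data.List.Membership.Propositional using (_∈_)
open import Data.List.Membership.Propositional.Properties using (∈-map⁺)
open import Data.Maybe using (just; nothing)
open import Data.Product using (Σ; ∃; _×_; _,_; proj₁; proj₂)
open import Data.Unit using (tt)
open import Data.Empty using (⊥-elim)
open import Relation.Binary.PropositionalEquality using (_≡_; refl)
open import Relation.Binary.Construct.Closure.ReflexiveTransitive using (Star; ε; _◅_; _◅◅_)

-- Level i of the graph consists of the nodes (u , i) with u ∈ g[s_i] ∩ I_B.
-- Condition (1) of the simulation makes every level nonempty, condition (3)
-- gives every node (u , i+1) an incoming edge from level i, and edges only go
-- from level i to level i+1.  Hence the roots are exactly level 0, and a path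
-- from a root to any node is obtained by walking back down the levels.  All
-- finiteness claims follow from finiteness of each g[s].

InRange-pred : ∀ m i → InRange m (suc i) → InRange m i
InRange-pred (just n) i i<n = <⇒≤ i<n
InRange-pred nothing  i _   = tt

module InducedGraphProperties {E} {A B : Automaton E} {MI : Set}
  (M : MI → CPair B) (IB : State B → Set) (g : State A → State B → Set) (h : MI → CPair A) (α : Exec A) where

  open InducedGraph M IB g h α

  level-finite : FiniteImage g → ∀ i →
    Σ (List (State B × ℕ)) λ xs → ∀ u → g (st α i) u → (u , i) ∈ xs
  level-finite g-fin i =
    map (_, i) (proj₁ (g-fin (st α i))) ,
    λ u gu → ∈-map⁺ (_, i) (proj₂ (g-fin (st α i)) u gu)

  Edge-level : ∀ {x y} → Edge x y → proj₂ y ≡ suc (proj₂ x)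
  Edge-level (_ , _ , i'≡1+i , _) = i'≡1+i

  Node-level0⇒Root : ∀ {u} → Node (u , 0) → Root (u , 0)
  Node-level0⇒Root nd = nd , λ (_ , e) → 0≢1+n (Edge-level e)

  module _ {LI : Set} {L : LI → CPair A} {IA : State A → Set}
    (invA : Invariant A IA) (ilb : ILB A B L M IA IB g h) where

    open ILB ilb

    Node-exists : ∀ i → InRange (len α) i → ∃ λ u → Node (u , i)
    Node-exists i i∈α with c1 (st α i) (invA α i i∈α)
    ... | u , gu , IBu = u , i∈α , gu , IBu

    incoming-Edge : ∀ {u j} → Node (u , suc j) → ∃ λ v → Edge (v , j) (u , suc j)
    incoming-Edge {u} {j} nd@(j+1∈α , gu , IBu) =
      let j∈α = InRange-pred (len α) j j+1∈α
          v , gv , IBv , β , tr , pc =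
            c3 (st α j) (act α j) (st α (suc j)) (steps α j j+1∈α) (invA α j j∈α) u gu IBu
      in v , (j∈α , gv , IBv) , nd , refl , β , tr , pc

    Root⇔level0 : ∀ x → Node x → (Root x → proj₂ x ≡ 0) × (proj₂ x ≡ 0 → Root x)
    Root⇔level0 (u , zero)  nd = (λ _ → refl) , (λ _ → Node-level0⇒Root nd)
    Root⇔level0 (u , suc j) nd =
      (λ (_ , no-in) → ⊥-elim (no-in (_ , proj₂ (incoming-Edge nd)))) , λ ()

    roots-finite : Σ (List (State B × ℕ)) λ xs → ∀ x → Root x → x ∈ xs
    roots-finite with level-finite g-fin 0
    ... | xs , covers = xs , λ where
      (u , zero)  ((_ , gu , _) , _) → covers u gu
      (u , suc j) (nd , no-in)       → ⊥-elim (no-in (_ , proj₂ (incoming-Edge nd)))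

    outdegree-finite : ∀ x → Σ (List (State B × ℕ)) λ xs → ∀ y → Edge x y → y ∈ xs
    outdegree-finite (u , i) with level-finite g-fin (suc i)
    ... | xs , covers = xs , λ where
      (u' , _) (_ , (_ , gu' , _) , refl , _) → covers u' gu'

    reachable-from-Root : ∀ i {u} → Node (u , i) → ∃ λ r → Root r × Star Edge r (u , i)
    reachable-from-Root zero    nd = _ , Node-level0⇒Root nd , ε
    reachable-from-Root (suc j) nd with incoming-Edge nd
    ... | v , e with reachable-from-Root j (proj₁ e)
    ... | r , root , path = r , root , path ◅◅ (e ◅ ε)

lemma6 : ∀ {E : Set} (A B : Automaton E) {LI MI : Set}
    (L : LI → CPair A) (M : MI → CPair B) →
    IsLive A L → IsLive B M →
    (IA : State A → Set) (IB : State B → Set) →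
    Invariant A IA → Invariant B IB →
    (g : State A → State B → Set) (h : MI → CPair A) →
    ILB A B L M IA IB g h →
    (α : Exec A) →
    let open InducedGraph M IB g h α in
      (∀ i → InRange (len α) i → ∃ λ u → Node (u , i))
    × (∀ x → Node x → (Root x → proj₂ x ≡ 0) × (proj₂ x ≡ 0 → Root x))
    × (Σ (List (State B × ℕ)) λ xs → ∀ x → Root x → x ∈ xs)
    × (∀ x → Node x → Σ (List (State B × ℕ)) λ xs → ∀ y → Edge x y → y ∈ xs)
    × (∀ x → Node x → ∃ λ r → Root r × Star Edge r x)
lemma6 A B L M _ _ IA IB invA _ g h ilb α =
    Node-exists invA ilb
  , Root⇔level0 invA ilb
  , roots-finite invA ilb
  , (λ x _ → outdegree-finite invA ilb x)
  , (λ (u , i) → reachable-from-Root invA ilb i)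
  where open InducedGraphProperties M IB g h α
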